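{- Let $G=(V,E)$ be a connected, undirected, unweighted graph, $R\subseteq V$ a set of landmarks and $H=(R,\delta_H)$ the highway. Let $L_1$ be the labelling produced by Algorithm 1 over $(G,H)$ and let $L_2$ be a pruned landmark labelling over $G$ using any labelling order over $R$ (both described in the context). Then $size(L_1)\le size(L_2)$.
   Context: $d_G(u,v)$ denotes the shortest-path distance in $G$. A highway is a pair $H=(R,\delta_H)$ with $\delta_H(r_1,r_2)=d_G(r_1,r_2)$ for all $r_1,r_2\in R$. A label $L(v)$ is a set of entries $(r,\delta_L(r,v))$ with $r\in R$ and $\delta_L(r,v)=d_G(r,v)$; the size of a labelling is $size(L)=\sum_{v}|L(v)|$ over all labelled vertices. Algorithm 1: initialise $L(v)=\emptyset$ for all $v\in V\setminus R$. For each $r_i\in R$ (in any order) run the following pruned BFS, in which each vertex is visited at most once and the root $r_i$ is visited at depth $0$. Keep two queues $\mathcal{Q}_{label}=\{r_i\}$ and $\mathcal{Q}_{prune}=\emptyset$ and set $n=0$. While $\mathcal{Q}_{label}$ contains vertices of depth $n$: (i) for each $u\in\mathcal{Q}_{label}$ at depth $n$ and each unvisited neighbour $v$ of $u$ (which becomes visited at depth $n+1$): if $v\in R$, enqueue $v$ to $\mathcal{Q}_{prune}$; otherwise enqueue $v$ to $\mathcal{Q}_{label}$ and add $(r_i,n+1)$ to $L(v)$; (ii) set $n\gets n+1$; (iii) for each $v\in\mathcal{Q}_{prune}$ at depth $n$, mark every unvisited neighbour of $v$ as visited at depth $n+1$ and enqueue it to $\mathcal{Q}_{prune}$ (no label is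 added). The output is $L$. For labels, $Q(s,t,L)=\min\{\delta_L(u,s)+\delta_L(u,t): (u,\delta_L(u,s))\in L(s),(u,\delta_L(u,t))\in L(t)\}$ ($\infty$ if no common landmark). Pruned landmark labelling with order $r_1,\dots,r_k$ of $R$: start with $L(v)=\emptyset$ for all $v\in V$; for $i=1,\dots,k$ run a BFS from $r_i$ in which, when a vertex $u$ at BFS distance $d$ from $r_i$ is processed, if $Q(r_i,u,L)\le d$ (with $L$ the labels built by the previous BFSs) then $u$ is pruned (no entry added and its neighbours are not expanded from $u$), and otherwise $(r_i,d)$ is added to $L(u)$ and its unvisited neighbours are enqueued at distance $d+1$. -}

module Defs where

open import Data.Nat using (ℕ; zero; suc; _+_; _≤ᵇ_; _⊓_)
open import Data.Bool using (Bool; true; false; _∧_; _∨_; not; if_then_else_)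
open import Data.Fin using (Fin; zero; suc; _≟_)
open import Data.Maybe using (Maybe; just; nothing; is-just)
open import Data.List using (List; []; _∷_; foldl)
open import Relation.Nullary.Decidable using (⌊_⌋)
open import Relation.Binary.PropositionalEquality using (_≡_)
open import Function using (_∘_)

Graph : ℕ → Set
Graph n = Fin n → Fin n → Bool

VSet : ℕ → Set
VSet n = Fin n → Bool

Undirected : ∀ {n} → Graph n → Set
Undirected G = ∀ u v → G u v ≡ G v u

Loopless : ∀ {n} → Graph n → Set
Loopless G = ∀ v → G v v ≡ false

data Reachable {n} (G : Graph n) : Fin n → Fin n → Set where
  here : ∀ {v} → Reachable G v v
  step : ∀ {u w v} → G u w ≡ true → Reachable G w v → Reachable G u v

Connected : ∀ {n} → Graph n → Set
Connected G = ∀ u v → Reachable G u v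

anyV : ∀ {n} → VSet n → Bool
anyV {zero} f = false
anyV {suc n} f = f zero ∨ anyV (f ∘ suc)

sumV : ∀ {n} → (Fin n → ℕ) → ℕ
sumV {zero} f = 0
sumV {suc n} f = f zero + sumV (f ∘ suc)

_∪_ : ∀ {n} → VSet n → VSet n → VSet n
(A ∪ B) x = A x ∨ B x

∅ : ∀ {n} → VSet n
∅ _ = false

singleton : ∀ {n} → Fin n → VSet n
singleton r v = ⌊ v ≟ r ⌋

expand : ∀ {n} → Graph n → VSet n → VSet n → VSet n
expand G V S w = not (V w) ∧ anyV (λ u → S u ∧ G u w)

-- Labellings.  L r v ≡ just δ  iff  (r , δ) ∈ L(v).
-- (Each label contains at most one entry per landmark.)

Labelling : ℕ → Set
Labelling n = Fin n → Fin n → Maybe ℕ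

emptyL : ∀ {n} → Labelling n
emptyL _ _ = nothing

size : ∀ {n} → Labelling n → ℕ
size L = sumV (λ r → sumV (λ v → if is-just (L r v) then 1 else 0))

-- State: visited set V, label queue FL (vertices of depth d),
-- prune queue FP (vertices of depth d+1 already enqueued by step (iii)),
-- current depth d, and the row of labels produced from r so far.
-- One iteration = steps (i),(ii),(iii).  n iterations suffice
-- (BFS depths are < n); extra iterations change nothing in the labels.

a1loop : ∀ {n} → Graph n → VSet n → ℕ →
         (V FL FP : VSet n) → ℕ → (Fin n → Maybe ℕ) → (Fin n → Maybe ℕ)
a1loop G R zero    V FL FP d row = row
a1loop G R (suc k) V FL FP d row = a1loop G R k V2 FL' M (suc d) row'
  where
  N   = expand G V FL                 -- step (i): new vertices, depth d+1
  V1  = V ∪ N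
  FL' = λ v → N v ∧ not (R v)
  P   = λ v → FP v ∨ (N v ∧ R v)
  M   = expand G V1 P                  -- step (iii): depth d+2, to Q_prune
  V2  = V1 ∪ M
  row' = λ v → if FL' v then just (suc d) else row v

algorithm1 : ∀ {n} → Graph n → VSet n → Labelling n
algorithm1 {n} G R r =
  if R r then a1loop G R n (singleton r) (singleton r) ∅ 0 (λ _ → nothing)
         else (λ _ → nothing)

minM : Maybe ℕ → Maybe ℕ → Maybe ℕ
minM nothing  y        = y
minM (just x) nothing  = just x
minM (just x) (just y) = just (x ⊓ y)

addM : Maybe ℕ → Maybe ℕ → Maybe ℕ
addM (just x) (just y) = just (x + y)
addM _ _ = nothing

minOver : ∀ {n} → (Fin n → Maybe ℕ) → Maybe ℕ
minOver {zero} f = nothing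
minOver {suc n} f = minM (f zero) (minOver (f ∘ suc))

-- Q(s,t,L); nothing = ∞
Q : ∀ {n} → Fin n → Fin n → Labelling n → Maybe ℕ
Q s t L = minOver (λ u → addM (L u s) (L u t))

≤M : Maybe ℕ → ℕ → Bool
≤M nothing  d = false
≤M (just q) d = q ≤ᵇ d

-- BFS from r, layer by layer: F = vertices at distance d (enqueued),
-- V = visited/enqueued vertices; Lprev = labels of previous BFSs.
pllLoop : ∀ {n} → Graph n → Labelling n → Fin n → ℕ →
          (V F : VSet n) → ℕ → (Fin n → Maybe ℕ) → (Fin n → Maybe ℕ)
pllLoop G Lprev r zero    V F d row = row
pllLoop G Lprev r (suc k) V F d row = pllLoop G Lprev r k (V ∪ N) N (suc d) row'
  where
  U    = λ u → F u ∧ not (≤M (Q r u Lprev) d)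
  row' = λ u → if U u then just d else row u
  N    = expand G V U

pllStep : ∀ {n} → Graph n → Labelling n → Fin n → Labelling n
pllStep {n} G L r x =
  if ⌊ x ≟ r ⌋ then pllLoop G L r n (singleton r) (singleton r) 0 (λ _ → nothing)
               else L x

prunedLandmarkLabelling : ∀ {n} → Graph n → List (Fin n) → Labelling n
prunedLandmarkLabelling G order = foldl (pllStep G) emptyL order

module Submission where

-- The inequality is proved entry by entry: every entry
-- (r , δ) that Algorithm 1 puts into L₁(v) also occurs in L₂(v).
-- The pivot is the notion of an *essential* pair (r , v , δ): δ is the
-- length of a shortest walk from r to v, and no landmark l ≠ r admits a
-- detour r ⇝ l ⇝ v of length ≤ δ.
--   * Algorithm 1 is sound for essential pairs: an invariant of its
--     layer-by-layer loop shows that every label it writes is essential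
--     (a vertex reached at depth d+1 through a landmark is put into the
--     prune queue, so it can never be labelled later).
--   * Pruned landmark labelling is complete for essential pairs: its
--     labels are lengths of genuine walks, so a pruning test Q(r,u,L) ≤ d
--     exhibits a detour; hence an essential vertex is never pruned, and an
--     invariant of the BFS from r shows that it gets labelled.  Induction
--     over the (duplicate-free) order transports this to the whole labelling.

open import Defs
open import Data.Nat using (ℕ; zero; suc; _+_; _∸_; _≤_; _<_; z≤n; s≤s; _<?_)
open import Data.Nat.Properties
  using (≤-refl; ≤-trans; ≤-pred; +-suc; +-identityʳ; +-mono-≤; +-monoʳ-<; ⊓-sel;
         m∸n+n≡m; m≤n⇒m<n∨m≡n; m≤n⇒m≤1+n; ≮⇒≥; n<1+n; ≤ᵇ⇒≤)
open import Data.Bool using (true; false; _∧_; _∨_; not; if_then_else_; T)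
open import Data.Bool.Properties using (∧-zeroʳ)
open import Data.Unit using (tt)
open import Data.Fin using (Fin; zero; suc; _≟_; toℕ)
open import Data.Fin.Properties using (pigeonhole; toℕ<n)
open import Data.Maybe using (Maybe; just; nothing; is-just)
open import Data.Product using (∃; _×_; _,_; proj₁; proj₂)
open import Data.Sum using (_⊎_; inj₁; inj₂)
open import Data.Empty using (⊥; ⊥-elim)
open import Data.List using (List; []; _∷_; foldl)
open import Data.List.Membership.Propositional using (_∈_; _∉_)
open import Data.List.Relation.Unary.Any using (here; there)
open import Data.List.Relation.Unary.AllPairs using (_∷_)
open import Data.List.Relation.Unary.Unique.Propositional using (Unique)
open import Data.List.Relation.Unary.Unique.Propositional.Properties using (Unique[x∷xs]⇒x∉xs)
open import Function using (_∘_)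
open import Function.Bundles using (_⇔_; Equivalence)
open import Relation.Nullary using (¬_; yes; no)
open import Relation.Binary.PropositionalEquality
  using (_≡_; _≢_; refl; sym; trans; cong; subst)

boolCases : ∀ b → b ≡ true ⊎ b ≡ false
boolCases true  = inj₁ refl
boolCases false = inj₂ refl

true≢false : ∀ {a} → a ≡ true → a ≡ false → ⊥
true≢false refl ()

∨-introˡ : ∀ {a b} → a ≡ true → a ∨ b ≡ true
∨-introˡ refl = refl

∨-introʳ : ∀ {a b} → b ≡ true → a ∨ b ≡ true
∨-introʳ {true}  _ = refl
∨-introʳ {false} p = p

∨-elim : ∀ {a b} → a ∨ b ≡ true → a ≡ true ⊎ b ≡ true
∨-elim {true}  _ = inj₁ refl
∨-elim {false} p = inj₂ p

∧-intro : ∀ {a b} → a ≡ true → b ≡ true → a ∧ b ≡ true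
∧-intro refl refl = refl

∧-elim : ∀ {a b} → a ∧ b ≡ true → a ≡ true × b ≡ true
∧-elim {true} {true} _ = refl , refl

not-intro : ∀ {a} → a ≡ false → not a ≡ true
not-intro refl = refl

not-elim : ∀ {a} → not a ≡ true → a ≡ false
not-elim {false} _ = refl

∧-not-false : ∀ {a b} → a ≡ true → a ∧ not b ≡ false → b ≡ true
∧-not-false {b = true}  _    _ = refl
∧-not-false {b = false} refl ()

if-just-intro : ∀ c d (m : Maybe ℕ) → c ≡ true ⊎ is-just m ≡ true →
                is-just (if c then just d else m) ≡ true
if-just-intro true  d m _        = refl
if-just-intro false d m (inj₂ p) = p

if-just-elim : ∀ c d (m : Maybe ℕ) → is-just (if c then just d else m) ≡ true →
               c ≡ true ⊎ is-just m ≡ true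
if-just-elim true  d m _ = inj₁ refl
if-just-elim false d m p = inj₂ p

if-value-elim : ∀ c d (m : Maybe ℕ) {e} → (if c then just d else m) ≡ just e →
                (c ≡ true × d ≡ e) ⊎ m ≡ just e
if-value-elim true  d m refl = inj₁ (refl , refl)
if-value-elim false d m p    = inj₂ p

anyV-intro : ∀ {n} (f : VSet n) u → f u ≡ true → anyV f ≡ true
anyV-intro f zero    p = ∨-introˡ p
anyV-intro f (suc u) p = ∨-introʳ {f zero} (anyV-intro (f ∘ suc) u p)

anyV-elim : ∀ {n} (f : VSet n) → anyV f ≡ true → ∃ λ u → f u ≡ true
anyV-elim {zero}  f ()
anyV-elim {suc n} f p with ∨-elim {f zero} p
... | inj₁ q = zero , q
... | inj₂ q with anyV-elim (f ∘ suc) q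
...   | u , fu = suc u , fu

singleton-intro : ∀ {n} (r : Fin n) → singleton r r ≡ true
singleton-intro r with r ≟ r
... | yes _  = refl
... | no r≢r = ⊥-elim (r≢r refl)

singleton-elim : ∀ {n} {r x : Fin n} → singleton r x ≡ true → x ≡ r
singleton-elim {r = r} {x} p with x ≟ r
... | yes x≡r = x≡r
singleton-elim () | no _

module _ {n} (G : Graph n) where

  expand-elim : ∀ V S w → expand G V S w ≡ true →
                V w ≡ false × ∃ λ u → S u ≡ true × G u w ≡ true
  expand-elim V S w p with ∧-elim {not (V w)} p
  ... | unvisited , adjacent with anyV-elim (λ u → S u ∧ G u w) adjacent
  ...   | u , q = not-elim unvisited , u , ∧-elim q

  expand-intro : ∀ V S w u → V w ≡ false → S u ≡ true → G u w ≡ true →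
                 expand G V S w ≡ true
  expand-intro V S w u unvisited Su edge =
    ∧-intro (not-intro unvisited) (anyV-intro (λ u → S u ∧ G u w) u (∧-intro Su edge))

  expand-covers : ∀ V S w u → S u ≡ true → G u w ≡ true → (V ∪ expand G V S) w ≡ true
  expand-covers V S w u Su edge with boolCases (V w)
  ... | inj₁ visited   = ∨-introˡ visited
  ... | inj₂ unvisited = ∨-introʳ {V w} (expand-intro V S w u unvisited Su edge)

data Walk {n} (G : Graph n) : Fin n → Fin n → ℕ → Set where
  nil  : ∀ {a} → Walk G a a 0
  snoc : ∀ {a b c k} → Walk G a b k → G b c ≡ true → Walk G a c (suc k)

NoShorter : ∀ {n} → Graph n → Fin n → Fin n → ℕ → Set
NoShorter G a b d = ∀ e → e < d → ¬ Walk G a b e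

module _ {n} {G : Graph n} where

  walk₀ : ∀ {a b} → Walk G a b 0 → a ≡ b
  walk₀ nil = refl

  _++ʷ_ : ∀ {a b c k m} → Walk G a b k → Walk G b c m → Walk G a c (m + k)
  w ++ʷ nil        = w
  w ++ʷ snoc v e   = snoc (w ++ʷ v) e

  consʷ : ∀ {a b c k} → G a b ≡ true → Walk G b c k → Walk G a c (suc k)
  consʷ e nil         = snoc nil e
  consʷ e (snoc w e′) = snoc (consʷ e w) e′

  reverseʷ : Undirected G → ∀ {a b k} → Walk G a b k → Walk G b a k
  reverseʷ und nil        = nil
  reverseʷ und (snoc w e) = consʷ (trans (und _ _) e) (reverseʷ und w)

  split : ∀ i j {a b} → Walk G a b (j + i) → ∃ λ c → Walk G a c i × Walk G c b j
  split i zero    w          = _ , w , nil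
  split i (suc j) (snoc w e) with split i j w
  ... | c , prefix , suffix = c , prefix , snoc suffix e

  splitAt : ∀ {a b k} i → i ≤ k → Walk G a b k → ∃ λ c → Walk G a c i × Walk G c b (k ∸ i)
  splitAt {k = k} i i≤k w = split i (k ∸ i) (subst (Walk G _ _) (sym (m∸n+n≡m i≤k)) w)

  -- Shortest walks repeat no vertex, so they have fewer than n edges: among the
  -- n+1 prefixes two end at the same vertex, and cutting out the loop between
  -- them yields a shorter walk.
  shortest<n : ∀ {a b k} → Walk G a b k → NoShorter G a b k → k < n
  shortest<n {a} {b} {k} w noShorter with k <? n
  ... | yes k<n = k<n
  ... | no  k≮n = ⊥-elim (noShorter _ shortcut<k shortcut)
    where
    index≤k : (x : Fin (suc n)) → toℕ x ≤ k
    index≤k x = ≤-trans (≤-pred (toℕ<n x)) (≮⇒≥ k≮n)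
    vertexAt : Fin (suc n) → Fin n
    vertexAt x = proj₁ (splitAt (toℕ x) (index≤k x) w)
    repeated = pigeonhole (n<1+n n) vertexAt
    i = proj₁ repeated
    j = proj₁ (proj₂ repeated)
    i<j = proj₁ (proj₂ (proj₂ repeated))
    sameVertex = proj₂ (proj₂ (proj₂ repeated))
    prefix = proj₁ (proj₂ (splitAt (toℕ i) (index≤k i) w))
    suffix = proj₂ (proj₂ (splitAt (toℕ j) (index≤k j) w))
    shortcut : Walk G a b (k ∸ toℕ j + toℕ i)
    shortcut = prefix ++ʷ subst (λ c → Walk G c b (k ∸ toℕ j)) (sym sameVertex) suffix
    shortcut<k : k ∸ toℕ j + toℕ i < k
    shortcut<k = subst (k ∸ toℕ j + toℕ i <_) (m∸n+n≡m (index≤k j)) (+-monoʳ-< (k ∸ toℕ j) i<j)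

module Essentials {n} (G : Graph n) (R : VSet n) (r : Fin n) where

  data Detour (x : Fin n) (d : ℕ) : Set where
    detour : ∀ {l a b} → R l ≡ true → l ≢ r → Walk G r l a → Walk G l x b →
             a + b ≤ d → Detour x d

  Essential : Fin n → ℕ → Set
  Essential x d = Walk G r x d × NoShorter G r x d × ¬ Detour x d

  detour-extend : ∀ {y x d} → Detour y d → G y x ≡ true → Detour x (suc d)
  detour-extend {d = d} (detour {a = a} {b} Rl l≢r toL fromL short) edge =
    detour Rl l≢r toL (snoc fromL edge) (subst (_≤ suc d) (sym (+-suc a b)) (s≤s short))

  detour-last : ∀ {x d} → Detour x (suc d) →
                (R x ≡ true × ∃ λ a → a ≤ suc d × Walk G r x a) ⊎
                (∃ λ y → Detour y d × G y x ≡ true)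
  detour-last {d = d} (detour {a = a} Rl l≢r toL nil short) =
    inj₁ (Rl , a , subst (_≤ suc d) (+-identityʳ a) short , toL)
  detour-last {d = d} (detour {a = a} {suc b} Rl l≢r toL (snoc fromL edge) short) =
    inj₂ (_ , detour Rl l≢r toL fromL (≤-pred (subst (_≤ suc d) (+-suc a b) short)) , edge)

  no-detour₀ : ∀ {x} → ¬ Detour x 0
  no-detour₀ (detour {a = zero} Rl l≢r toL fromL short) = l≢r (sym (walk₀ toL))

  essential-root : Essential r 0
  essential-root = nil , (λ { _ () _ }) , no-detour₀

  essential-prefix : ∀ {w x d} → Walk G r w d → G w x ≡ true →
                     NoShorter G r x (suc d) → ¬ Detour x (suc d) → Essential w d
  essential-prefix toW edge noShorter noDetour =
    toW ,
    (λ e e<d shorter → noShorter (suc e) (s≤s e<d) (snoc shorter edge)) ,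
    (λ dt → noDetour (detour-extend dt edge))

module Algorithm1 {n} (G : Graph n) (R : VSet n) (r : Fin n) where
  open Essentials G R r

  Row : Set
  Row = Fin n → Maybe ℕ

  RowEssential : Row → Set
  RowEssential row = ∀ x → is-just (row x) ≡ true → ∃ λ δ → Essential x δ

  record Invariant (V FL FP : VSet n) (d : ℕ) (row : Row) : Set where
    field
      labelsEssential        : RowEssential row
      queueEssential         : ∀ x → FL x ≡ true → Essential x d
      nearVisited            : ∀ x e → Walk G r x e → e ≤ d → V x ≡ true
      -- vertices one step beyond a detour are already claimed by the prune queue
      detourNeighbourVisited : ∀ y x → Detour y d → G y x ≡ true → V x ≡ true
      closedOffQueue         : ∀ z x → Walk G r z d → FL z ≡ false → G z x ≡ true → V x ≡ true
      visitedDepth           : ∀ x → V x ≡ true → FP x ≡ true ⊎ ∃ λ e → e ≤ d × Walk G r x e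
      pruneQueueDepth        : ∀ x → FP x ≡ true → Walk G r x (suc d)

  -- One iteration (steps (i)–(iii)) preserves the invariant; the names
  -- below match the local definitions of `a1loop`.
  module Iteration {V FL FP : VSet n} {d : ℕ} {row : Row} (I : Invariant V FL FP d row) where
    open Invariant I

    N V1 FL′ P M V2 : VSet n
    N      = expand G V FL
    V1     = V ∪ N
    FL′ v  = N v ∧ not (R v)
    P v    = FP v ∨ (N v ∧ R v)
    M      = expand G V1 P
    V2     = V1 ∪ M

    row′ : Row
    row′ v = if FL′ v then just (suc d) else row v

    new-depth : ∀ x → N x ≡ true → Walk G r x (suc d)
    new-depth x p with expand-elim G V FL x p
    ... | _ , u , queued , edge = snoc (proj₁ (queueEssential u queued)) edge

    new-unvisited : ∀ x → N x ≡ true → V x ≡ false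
    new-unvisited x p = proj₁ (expand-elim G V FL x p)

    V1⇒V2 : ∀ x → V1 x ≡ true → V2 x ≡ true
    V1⇒V2 x = ∨-introˡ

    nearVisited₁ : ∀ x e → Walk G r x e → e ≤ suc d → V1 x ≡ true
    nearVisited₁ x e w e≤ with m≤n⇒m<n∨m≡n e≤
    ... | inj₁ e<  = ∨-introˡ (nearVisited x e w (≤-pred e<))
    nearVisited₁ x _ (snoc {b = z} toZ edge) _ | inj₂ refl with boolCases (FL z)
    ... | inj₁ queued    = expand-covers G V FL x z queued edge
    ... | inj₂ notQueued = ∨-introˡ (closedOffQueue z x toZ notQueued edge)

    visitedNeighbour : ∀ y x → V y ≡ true → G y x ≡ true → V2 x ≡ true
    visitedNeighbour y x visited edge with visitedDepth y visited
    ... | inj₁ pruned          = expand-covers G V1 P x y (∨-introˡ pruned) edge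
    ... | inj₂ (e , e≤d , toY) = V1⇒V2 x (nearVisited₁ x (suc e) (snoc toY edge) (s≤s e≤d))

    -- A vertex reached so far but not labelled at depth d+1 has all
    -- neighbours visited: either it was visited before, or it is a new
    -- landmark and enters the prune queue.
    closedUnlessLabelled : ∀ y x → V1 y ≡ true → FL′ y ≡ false → G y x ≡ true → V2 x ≡ true
    closedUnlessLabelled y x reached notLabelled edge with boolCases (V y)
    ... | inj₁ visited = visitedNeighbour y x visited edge
    ... | inj₂ unvisited with ∨-elim {V y} reached
    ...   | inj₁ visited = ⊥-elim (true≢false visited unvisited)
    ...   | inj₂ new     =
      expand-covers G V1 P x y (∨-introʳ {FP y} (∧-intro new (∧-not-false new notLabelled))) edge

    -- A vertex labelled at depth d+1 is essential: it was not visited before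
    -- (no shorter walk, no detour reaching it).
    queueEssential′ : ∀ x → FL′ x ≡ true → Essential x (suc d)
    queueEssential′ x p with ∧-elim {N x} p
    ... | new , notLandmark = new-depth x new , noShorter , noDetour
      where
      noShorter : NoShorter G r x (suc d)
      noShorter e e<sd shorter =
        true≢false (nearVisited x e shorter (≤-pred e<sd)) (new-unvisited x new)
      noDetour : ¬ Detour x (suc d)
      noDetour dt with detour-last dt
      ... | inj₁ (landmark , _) = true≢false landmark (not-elim notLandmark)
      ... | inj₂ (y , dy , edge) =
        true≢false (detourNeighbourVisited y x dy edge) (new-unvisited x new)

    landmark-unlabelled : ∀ y → R y ≡ true → FL′ y ≡ false
    landmark-unlabelled y landmark =
      subst (λ b → N y ∧ not b ≡ false) (sym landmark) (∧-zeroʳ (N y))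

    labelsEssential′ : RowEssential row′
    labelsEssential′ x p with if-just-elim (FL′ x) (suc d) (row x) p
    ... | inj₁ labelled = suc d , queueEssential′ x labelled
    ... | inj₂ old      = labelsEssential x old

    detourNeighbourVisited′ : ∀ y x → Detour y (suc d) → G y x ≡ true → V2 x ≡ true
    detourNeighbourVisited′ y x dt edge with detour-last dt
    ... | inj₁ (landmark , a , a≤ , toY) =
      closedUnlessLabelled y x (nearVisited₁ y a toY a≤) (landmark-unlabelled y landmark) edge
    ... | inj₂ (y′ , dy′ , edge′) =
      visitedNeighbour y x (detourNeighbourVisited y′ y dy′ edge′) edge

    visitedDepth′ : ∀ x → V2 x ≡ true → M x ≡ true ⊎ ∃ λ e → e ≤ suc d × Walk G r x e
    visitedDepth′ x p with ∨-elim {V1 x} p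
    ... | inj₂ pruned = inj₁ pruned
    ... | inj₁ reached with ∨-elim {V x} reached
    ...   | inj₂ new = inj₂ (suc d , ≤-refl , new-depth x new)
    ...   | inj₁ visited with visitedDepth x visited
    ...     | inj₁ queued          = inj₂ (suc d , ≤-refl , pruneQueueDepth x queued)
    ...     | inj₂ (e , e≤d , toX) = inj₂ (e , m≤n⇒m≤1+n e≤d , toX)

    pruneQueueDepth′ : ∀ x → M x ≡ true → Walk G r x (suc (suc d))
    pruneQueueDepth′ x p with expand-elim G V1 P x p
    ... | _ , u , inP , edge with ∨-elim {FP u} inP
    ...   | inj₁ queued      = snoc (pruneQueueDepth u queued) edge
    ...   | inj₂ newLandmark = snoc (new-depth u (proj₁ (∧-elim newLandmark))) edge

    invariant′ : Invariant V2 FL′ M (suc d) row′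
    invariant′ = record
      { labelsEssential        = labelsEssential′
      ; queueEssential         = queueEssential′
      ; nearVisited            = λ x e w e≤ → V1⇒V2 x (nearVisited₁ x e w e≤)
      ; detourNeighbourVisited = detourNeighbourVisited′
      ; closedOffQueue         = λ z x toZ → closedUnlessLabelled z x (nearVisited₁ z _ toZ ≤-refl)
      ; visitedDepth           = visitedDepth′
      ; pruneQueueDepth        = pruneQueueDepth′
      }

  iterate : ∀ k {V FL FP d row} → Invariant V FL FP d row → RowEssential (a1loop G R k V FL FP d row)
  iterate zero    I = Invariant.labelsEssential I
  iterate (suc k) I = iterate k (Iteration.invariant′ I)

  initial : Invariant (singleton r) (singleton r) ∅ 0 (λ _ → nothing)
  initial = record
    { labelsEssential        = λ _ ()
    ; queueEssential         = λ x p → subst (λ y → Essential y 0) (sym (singleton-elim p)) essential-root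
    ; nearVisited            = λ { x .0 w z≤n → subst (λ y → singleton r y ≡ true) (walk₀ w) (singleton-intro r) }
    ; detourNeighbourVisited = λ y x dt → ⊥-elim (no-detour₀ dt)
    ; closedOffQueue         = λ z x w notRoot _ →
        ⊥-elim (true≢false (subst (λ y → singleton r y ≡ true) (walk₀ w) (singleton-intro r)) notRoot)
    ; visitedDepth           = λ x p → inj₂ (0 , z≤n , subst (λ y → Walk G r y 0) (sym (singleton-elim p)) nil)
    ; pruneQueueDepth        = λ _ ()
    }

algorithm1-essential : ∀ {n} (G : Graph n) (R : VSet n) r v →
                       is-just (algorithm1 G R r v) ≡ true →
                       R r ≡ true × ∃ λ δ → Essentials.Essential G R r v δ
algorithm1-essential {n} G R r v p with R r
... | true  = refl , Algorithm1.iterate G R r n (Algorithm1.initial G R r) v p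

minM-elim : ∀ {x y q} → minM x y ≡ just q → x ≡ just q ⊎ y ≡ just q
minM-elim {nothing}           p = inj₂ p
minM-elim {just x} {nothing}  p = inj₁ p
minM-elim {just x} {just y} refl with ⊓-sel x y
... | inj₁ eq = inj₁ (cong just (sym eq))
... | inj₂ eq = inj₂ (cong just (sym eq))

minOver-elim : ∀ {n} (f : Fin n → Maybe ℕ) {q} → minOver f ≡ just q → ∃ λ u → f u ≡ just q
minOver-elim {zero}  f ()
minOver-elim {suc n} f p with minM-elim {f zero} p
... | inj₁ eq = zero , eq
... | inj₂ eq with minOver-elim (f ∘ suc) eq
...   | u , fu = suc u , fu

addM-elim : ∀ {x y q} → addM x y ≡ just q → ∃ λ a → ∃ λ b → x ≡ just a × y ≡ just b × a + b ≡ q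
addM-elim {just a} {just b} refl = a , b , refl , refl , refl

query-witness : ∀ {n} (s t : Fin n) (L : Labelling n) d → ≤M (Q s t L) d ≡ true →
                ∃ λ l → ∃ λ a → ∃ λ b → L l s ≡ just a × L l t ≡ just b × a + b ≤ d
query-witness s t L d p with Q s t L in eq
... | just q with minOver-elim (λ u → addM (L u s) (L u t)) eq
...   | l , sum with addM-elim {L l s} sum
...     | a , b , ls , lt , refl = l , a , b , ls , lt , ≤ᵇ⇒≤ (a + b) d (subst T (sym p) tt)

module PrunedBFS {n} (G : Graph n) (r : Fin n) (Lp : Labelling n) where

  Row : Set
  Row = Fin n → Maybe ℕ

  -- The names below match the local definitions of `pllLoop`.
  Unpruned : VSet n → ℕ → VSet n
  Unpruned F d u = F u ∧ not (≤M (Q r u Lp) d)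

  Next : VSet n → VSet n → ℕ → VSet n
  Next V F d = expand G V (Unpruned F d)

  nextRow : VSet n → ℕ → Row → Row
  nextRow F d row u = if Unpruned F d u then just d else row u

  bfs : Row
  bfs = pllLoop G Lp r n (singleton r) (singleton r) 0 (λ _ → nothing)

  record Explored (V F : VSet n) (d : ℕ) : Set where
    field
      frontierDepth : ∀ x → F x ≡ true → Walk G r x d
      visitedDepth  : ∀ x → V x ≡ true → ∃ λ e → e ≤ d × Walk G r x e

  explored-start : Explored (singleton r) (singleton r) 0
  explored-start = record
    { frontierDepth = atRoot
    ; visitedDepth  = λ x p → 0 , z≤n , atRoot x p }
    where
    atRoot : ∀ x → singleton r x ≡ true → Walk G r x 0
    atRoot x p = subst (λ y → Walk G r y 0) (sym (singleton-elim p)) nil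

  next-depth : ∀ {V F d} → Explored V F d → ∀ x → Next V F d x ≡ true → Walk G r x (suc d)
  next-depth {V} {F} {d} ex x p with expand-elim G V (Unpruned F d) x p
  ... | _ , u , unpruned , edge =
    snoc (Explored.frontierDepth ex u (proj₁ (∧-elim unpruned))) edge

  explored-next : ∀ {V F d} → Explored V F d → Explored (V ∪ Next V F d) (Next V F d) (suc d)
  explored-next {V} {F} {d} ex = record
    { frontierDepth = next-depth ex
    ; visitedDepth  = visitedDepth′ }
    where
    visitedDepth′ : ∀ x → (V ∪ Next V F d) x ≡ true → ∃ λ e → e ≤ suc d × Walk G r x e
    visitedDepth′ x p with ∨-elim {V x} p
    ... | inj₂ new     = suc d , ≤-refl , next-depth ex x new
    ... | inj₁ visited with Explored.visitedDepth ex x visited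
    ...   | e , e≤d , toX = e , m≤n⇒m≤1+n e≤d , toX

  RowSound : Row → Set
  RowSound row = ∀ x e → row x ≡ just e → Walk G r x e

  pllLoop-sound : ∀ k {V F d row} → Explored V F d → RowSound row →
                  RowSound (pllLoop G Lp r k V F d row)
  pllLoop-sound zero    ex sound = sound
  pllLoop-sound (suc k) {V} {F} {d} {row} ex sound =
    pllLoop-sound k (explored-next ex) sound′
    where
    sound′ : RowSound (nextRow F d row)
    sound′ x e p with if-value-elim (Unpruned F d x) d (row x) p
    ... | inj₁ (unpruned , refl) = Explored.frontierDepth ex x (proj₁ (∧-elim unpruned))
    ... | inj₂ old               = sound x e old

  bfs-sound : RowSound bfs
  bfs-sound = pllLoop-sound n explored-start (λ _ _ ())

module PrunedBFSComplete {n} (G : Graph n) (und : Undirected G) (R : VSet n) (r : Fin n)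
    (Lp : Labelling n)
    (prior : ∀ l u b → Lp l u ≡ just b → R l ≡ true × l ≢ r × Walk G l u b) where
  open PrunedBFS G r Lp
  open Essentials G R r

  -- A pruning test that succeeds would exhibit a detour r ⇝ l ⇝ x.
  essential-unpruned : ∀ {x d} → Essential x d → ≤M (Q r x Lp) d ≡ false
  essential-unpruned {x} {d} (_ , _ , noDetour) with boolCases (≤M (Q r x Lp) d)
  ... | inj₂ notPruned = notPruned
  ... | inj₁ pruned with query-witness r x Lp d pruned
  ...   | l , a , b , lr , lx , a+b≤d with prior l r a lr | prior l x b lx
  ...     | landmark , l≢r , fromL | _ , _ , toX =
    ⊥-elim (noDetour (detour landmark l≢r (reverseʷ und fromL) toX a+b≤d))

  record Complete (V F : VSet n) (d : ℕ) (row : Row) : Set where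
    field
      explored         : Explored V F d
      frontierComplete : ∀ x → Essential x d → F x ≡ true
      rowComplete      : ∀ x e → Essential x e → e < d → is-just (row x) ≡ true

  complete-start : Complete (singleton r) (singleton r) 0 (λ _ → nothing)
  complete-start = record
    { explored         = explored-start
    ; frontierComplete = λ x ess →
        subst (λ y → singleton r y ≡ true) (walk₀ (proj₁ ess)) (singleton-intro r)
    ; rowComplete      = λ _ _ _ () }

  complete-next : ∀ {V F d row} → Complete V F d row →
                  Complete (V ∪ Next V F d) (Next V F d) (suc d) (nextRow F d row)
  complete-next {V} {F} {d} {row} c = record
    { explored         = explored-next explored
    ; frontierComplete = frontierComplete′
    ; rowComplete      = rowComplete′ }
    where
    open Complete c

    unpruned : ∀ x → Essential x d → Unpruned F d x ≡ true
    unpruned x ess = ∧-intro (frontierComplete x ess) (not-intro (essential-unpruned ess))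

    frontierComplete′ : ∀ x → Essential x (suc d) → Next V F d x ≡ true
    frontierComplete′ x (snoc {b = w} toW edge , noShorter , noDetour) =
      expand-intro G V (Unpruned F d) x w unvisited
        (unpruned w (essential-prefix toW edge noShorter noDetour)) edge
      where
      unvisited : V x ≡ false
      unvisited with boolCases (V x)
      ... | inj₂ unvisitedX = unvisitedX
      ... | inj₁ visited with Explored.visitedDepth explored x visited
      ...   | e , e≤d , shorter = ⊥-elim (noShorter e (s≤s e≤d) shorter)

    rowComplete′ : ∀ x e → Essential x e → e < suc d → is-just (nextRow F d row x) ≡ true
    rowComplete′ x e ess e<sd with m≤n⇒m<n∨m≡n (≤-pred e<sd)
    ... | inj₂ refl = if-just-intro (Unpruned F d x) d (row x) (inj₁ (unpruned x ess))
    ... | inj₁ e<d  = if-just-intro (Unpruned F d x) d (row x) (inj₂ (rowComplete x e ess e<d))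

  pllLoop-complete : ∀ k {V F d row} → Complete V F d row → ∀ {x e} → Essential x e →
                     e < k + d → is-just (pllLoop G Lp r k V F d row x) ≡ true
  pllLoop-complete zero    c ess e<d = Complete.rowComplete c _ _ ess e<d
  pllLoop-complete (suc k) {d = d} c {e = e} ess e< =
    pllLoop-complete k (complete-next c) ess (subst (e <_) (sym (+-suc k d)) e<)

  -- Distances are below n, so the n rounds of the BFS reach every essential vertex.
  bfs-complete : ∀ {x e} → Essential x e → is-just (bfs x) ≡ true
  bfs-complete {e = e} ess@(toX , noShorter , _) =
    pllLoop-complete n complete-start ess (subst (e <_) (sym (+-identityʳ n)) (shortest<n toX noShorter))

module _ {n} (G : Graph n) where

  pllStep-self : ∀ L (r : Fin n) v → pllStep G L r r v ≡ PrunedBFS.bfs G r L v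
  pllStep-self L r v with r ≟ r
  ... | yes _  = refl
  ... | no r≢r = ⊥-elim (r≢r refl)

  pllStep-other : ∀ L (r x : Fin n) v → x ≢ r → pllStep G L r x v ≡ L x v
  pllStep-other L r x v x≢r with x ≟ r
  ... | yes x≡r = ⊥-elim (x≢r x≡r)
  ... | no _    = refl

  fold-unchanged : ∀ ys L (x : Fin n) v → x ∉ ys → foldl (pllStep G) L ys x v ≡ L x v
  fold-unchanged []       L x v _    = refl
  fold-unchanged (y ∷ ys) L x v x∉ =
    trans (fold-unchanged ys (pllStep G L y) x v (x∉ ∘ there))
          (pllStep-other L y x v (x∉ ∘ here))

  module Order (und : Undirected G) (R : VSet n) where
    open Essentials G R

    Admissible : List (Fin n) → Labelling n → Set
    Admissible later L = ∀ l u b → L l u ≡ just b → R l ≡ true × l ∉ later × Walk G l u b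

    admissible-step : ∀ {y ys L} → Admissible (y ∷ ys) L → R y ≡ true → y ∉ ys →
                      Admissible ys (pllStep G L y)
    admissible-step {y} {L = L} adm landmark y∉ys l u b p with l ≟ y
    ... | yes refl = landmark , y∉ys , PrunedBFS.bfs-sound G l L u b p
    ... | no _ with adm l u b p
    ...   | landmarkL , l∉ , walk = landmarkL , l∉ ∘ there , walk

    fold-complete : ∀ order L → Unique order → (∀ v → v ∈ order → R v ≡ true) →
                    Admissible order L → ∀ {r x e} → r ∈ order → Essential r x e →
                    is-just (foldl (pllStep G) L order r x) ≡ true
    fold-complete (y ∷ ys) L unique _ adm {r} {x} (here refl) ess =
      subst (λ m → is-just m ≡ true)
        (sym (trans (fold-unchanged ys (pllStep G L r) r x (Unique[x∷xs]⇒x∉xs unique))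
                    (pllStep-self L r x)))
        (PrunedBFSComplete.bfs-complete G und R r L prior ess)
      where
      prior : ∀ l u b → L l u ≡ just b → R l ≡ true × l ≢ r × Walk G l u b
      prior l u b p with adm l u b p
      ... | landmark , l∉ , walk = landmark , (λ l≡r → l∉ (here l≡r)) , walk
    fold-complete (y ∷ ys) L unique@(_ ∷ uniqueYs) landmarks adm (there r∈ys) ess =
      fold-complete ys (pllStep G L y) uniqueYs (λ v → landmarks v ∘ there)
        (admissible-step adm (landmarks y (here refl)) (Unique[x∷xs]⇒x∉xs unique)) r∈ys ess

sumV-mono : ∀ {n} (f g : Fin n → ℕ) → (∀ i → f i ≤ g i) → sumV f ≤ sumV g
sumV-mono {zero}  f g f≤g = z≤n
sumV-mono {suc n} f g f≤g = +-mono-≤ (f≤g zero) (sumV-mono (f ∘ suc) (g ∘ suc) (f≤g ∘ suc))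

indicator-mono : ∀ (a b : Maybe ℕ) → (is-just a ≡ true → is-just b ≡ true) →
                 (if is-just a then 1 else 0) ≤ (if is-just b then 1 else 0)
indicator-mono nothing  nothing  _ = ≤-refl
indicator-mono nothing  (just _) _ = z≤n
indicator-mono (just _) (just _) _ = ≤-refl
indicator-mono (just _) nothing  a⇒b with a⇒b refl
... | ()

size-mono : ∀ {n} (L₁ L₂ : Labelling n) →
            (∀ r v → is-just (L₁ r v) ≡ true → is-just (L₂ r v) ≡ true) → size L₁ ≤ size L₂
size-mono L₁ L₂ sub =
  sumV-mono _ _ λ r → sumV-mono _ _ λ v → indicator-mono (L₁ r v) (L₂ r v) (sub r v)

corollary3p14 : ∀ {n} (G : Graph n) → Undirected G → Loopless G → Connected G →
                (R : VSet n) (order : List (Fin n)) → Unique order →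
                (∀ v → (v ∈ order) ⇔ (R v ≡ true)) →
                size (algorithm1 G R) ≤ size (prunedLandmarkLabelling G order)
corollary3p14 G und _ _ R order unique landmarks =
  size-mono (algorithm1 G R) (prunedLandmarkLabelling G order) entryKept
  where
  open Order G und R
  entryKept : ∀ r v → is-just (algorithm1 G R r v) ≡ true →
              is-just (prunedLandmarkLabelling G order r v) ≡ true
  entryKept r v p with algorithm1-essential G R r v p
  ... | landmark , δ , ess =
    fold-complete order emptyL unique (λ v → Equivalence.to (landmarks v)) (λ _ _ _ ())
      (Equivalence.from (landmarks r) landmark) ess
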